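{- There exist uniform hypergraphs $H$ such that the $h$-vector $h(\Delta_H)$ of the coloring complex has negative entries and $\Delta_H$ is not partitionable.
   Context: A hypergraph $H=([n],E)$ has vertex set $[n]$ and a set $E$ of subsets of $[n]$ (edges), with no edges of size at most $1$, no isolated vertices, and no edge properly contained in another; it is uniform if all edges have the same cardinality. The coloring complex $\Delta_H$ is the simplicial complex on the nonempty proper subsets of $[n]$ whose faces are chains $\emptyset\ne A_1\subsetneq\cdots\subsetneq A_l\ne[n]$ ($l\ge0$) such that, with $A_0=\emptyset$, $A_{l+1}=[n]$, some $A_i\setminus A_{i-1}$ contains an edge of $H$. For a $(d-1)$-dimensional simplicial complex $\Delta$ with $f_i$ faces of dimension $i$ ($f_{ -1}=1$), the $h$-vector $(h_0,\dots,h_d)$ is defined by $\sum_{i=0}^d h_it^{d-i}=\sum_{i=0}^d f_{i-1}(t-1)^{d-i}$. $\Delta$ is partitionable if it is a disjoint union of closed intervals $[G_j,F_j]=\{K: G_j\subseteq K\subseteq F_j\}$ where $F_1,\dots,F_m$ are its facets. -}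

module Defs where

open import Data.Bool using (true; false; if_then_else_)
open import Data.Nat as ℕ using (ℕ; zero; suc; _≤_; _<_; _∸_)
open import Data.Nat.Combinatorics using (_C_)
open import Data.Fin using (Fin)
open import Data.Fin.Subset using (Subset; ⊥; ⊤; _∈_; _⊆_; _⊂_; _─_; Nonempty; ∣_∣; inside; outside)
open import Data.Fin.Subset.Properties using (_⊆?_; _⊂?_; nonempty?)
open import Data.Vec using ([]; _∷_)
open import Data.Vec.Properties using (≡-dec)
open import Data.Bool.Properties using () renaming (_≟_ to _≟ᵇ_)
open import Data.List using (List; []; _∷_; [_]; _++_; map; concatMap; filter; length; upTo)
open import Data.List.Relation.Unary.All using (All; all?)
open import Data.List.Relation.Unary.Any using (Any; any?)
open import Data.List.Relation.Unary.Linked using (Linked; linked?)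
open import Data.List.Relation.Unary.Unique.Propositional using (Unique)
open import Data.List.Membership.Propositional using () renaming (_∈_ to _∈ₗ_)
open import Data.List.Relation.Binary.Subset.Propositional renaming (_⊆_ to _⊆ₗ_)
open import Data.Integer as ℤ using (ℤ; +_; -1ℤ)
open import Data.Product using (_×_; _,_; Σ; ∃; ∃-syntax)
open import Relation.Nullary using (¬_; Dec; yes; no; does)
open import Relation.Nullary.Decidable using (_×-dec_; ¬?)
open import Relation.Binary.PropositionalEquality using (_≡_; _≢_)

record Hypergraph : Set where
  field
    n         : ℕ
    edges     : List (Subset n)
    distinct  : Unique edges
    bigEdges  : All (λ e → 2 ≤ ∣ e ∣) edges
    noIsolated : (v : Fin n) → Any (λ e → v ∈ e) edges
    antichain : ∀ {e e′} → e ∈ₗ edges → e′ ∈ₗ edges → ¬ (e ⊂ e′)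

open Hypergraph public

Uniform : Hypergraph → Set
Uniform H = ∃[ k ] All (λ e → ∣ e ∣ ≡ k) (edges H)

-- The coloring complex Δ_H.
-- Its vertices are nonempty proper subsets of [n]; a face {A₁,…,A_l} is a
-- chain, represented canonically as the strictly increasing list
-- A₁ ⊊ A₂ ⊊ … ⊊ A_l.

Chain : ℕ → Set
Chain n = List (Subset n)

consec : ∀ {A : Set} → List A → List (A × A)
consec (x ∷ y ∷ xs) = (x , y) ∷ consec (y ∷ xs)
consec _            = []

NonemptyProper : ∀ {n} → Subset n → Set
NonemptyProper A = Nonempty A × A ≢ ⊤

StepHasEdge : ∀ {n} → List (Subset n) → Subset n × Subset n → Set
StepHasEdge E (X , Y) = Any (λ e → e ⊆ (Y ─ X)) E

IsFace : (H : Hypergraph) → Chain (n H) → Set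
IsFace H A =
  All NonemptyProper A ×
  Linked _⊂_ A ×
  Any (StepHasEdge (edges H)) (consec (⊥ ∷ A ++ [ ⊤ ]))

IsFacet : (H : Hypergraph) → Chain (n H) → Set
IsFacet H F = IsFace H F × (∀ K → IsFace H K → F ⊆ₗ K → K ⊆ₗ F)

isFace? : (H : Hypergraph) → (A : Chain (n H)) → Dec (IsFace H A)
isFace? H A =
  all? (λ B → nonempty? B ×-dec ¬? (≡-dec _≟ᵇ_ B ⊤)) A ×-dec
  linked? _⊂?_ A ×-dec
  any? (λ { (X , Y) → any? (λ e → e ⊆? (Y ─ X)) (edges H) }) (consec (⊥ ∷ A ++ [ ⊤ ]))

allSubsets : ∀ m → List (Subset m)
allSubsets zero    = [ [] ]
allSubsets (suc m) = map (inside ∷_) (allSubsets m) ++ map (outside ∷_) (allSubsets m)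

allLists : ∀ m → ℕ → List (Chain m)
allLists m zero    = [ [] ]
allLists m (suc l) = concatMap (λ x → map (x ∷_) (allLists m l)) (allSubsets m)

-- number of faces with exactly l elements, i.e. f_{l-1}(Δ_H)
faceCount : (H : Hypergraph) → ℕ → ℕ
faceCount H l = length (filter (isFace? H) (allLists (n H) l))

-- d = (dimension of Δ_H) + 1 = maximal number of elements of a face.
-- Faces are chains of nonempty proper subsets of [n], so have < n elements;
-- we search l = n, n-1, …, 0.
topSize : (H : Hypergraph) → ℕ → ℕ
topSize H zero    = zero
topSize H (suc l) = if does (1 ℕ.≤? faceCount H (suc l)) then suc l else topSize H l

dimΔ+1 : Hypergraph → ℕ
dimΔ+1 H = topSize H (n H)

-- h-vector.  Σ_k h_k t^{d-k} = Σ_i f_{i-1} (t-1)^{d-i}; expanding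
-- (t-1)^{d-i} = Σ_j C(d-i,j) t^j (-1)^{d-i-j}, the coefficient of t^{d-k} is
--   h_k = Σ_{i=0}^{k} (-1)^{k-i} C(d-i, k-i) f_{i-1}.

sumℤ : List ℤ → ℤ
sumℤ []       = + 0
sumℤ (x ∷ xs) = x ℤ.+ sumℤ xs

hEntry : Hypergraph → ℕ → ℤ
hEntry H k = sumℤ (map term (upTo (suc k)))
  where
    d = dimΔ+1 H
    term : ℕ → ℤ
    term i = (-1ℤ ℤ.^ (k ∸ i)) ℤ.* (+ ((d ∸ i) C (k ∸ i))) ℤ.* (+ faceCount H i)

HasNegativeHEntry : Hypergraph → Set
HasNegativeHEntry H = ∃[ k ] (k ≤ dimΔ+1 H × hEntry H k ℤ.< + 0)

-- Partitionability: Δ_H is a disjoint union of intervals [G_j, F_j]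
-- where F_1,…,F_m are exactly its facets (each listed once).

InInterval : ∀ {m} → Chain m → Chain m → Chain m → Set
InInterval G F K = G ⊆ₗ K × K ⊆ₗ F

Partitionable : Hypergraph → Set
Partitionable H =
  Σ ℕ λ m → Σ (Fin m → Chain (n H)) λ G → Σ (Fin m → Chain (n H)) λ F →
    (∀ j → IsFacet H (F j)) ×
    (∀ i j → F i ≡ F j → i ≡ j) ×
    (∀ K → IsFacet H K → ∃[ j ] F j ≡ K) ×
    (∀ j → IsFace H (G j) × G j ⊆ₗ F j) ×
    (∀ K → IsFace H K → ∃[ j ] InInterval (G j) (F j) K) ×
    (∀ K → IsFace H K → ∀ i j → InInterval (G i) (F i) K → InInterval (G j) (F j) K → i ≡ j)

-- The witness is the 3-uniform hypergraph H₀ on [6] with edges {0,1,2},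
-- {0,3,4}, {1,3,5}.  Its coloring complex has f-vector (1, 36, 108, 72), so
-- d = 3 and h₃ = f₂ - f₁ + f₀ - f₋₁ = 72 - 108 + 36 - 1 = -1.
--
-- Non-partitionability is a counting argument.  In a partition of Δ_{H₀} into
-- intervals [G_j, F_j], every facet F_j is a triangle (a 3-chain), and an
-- interval of a triangle contains at most one more edge than vertices, and no
-- more edges than vertices when G_j = ∅.  Summing over the m ≤ f₂ = 72
-- intervals, f₁ ≤ f₀ + m - 1 ≤ 107 < 108.
module Submission where

open import Defs
import Data.Nat.Properties as ℕP
open import Algebra.Properties.CommutativeMonoid.Sum ℕP.+-0-commutativeMonoid
  using (sum; sum-remove; sum-cong-≗; sum-replicate-zero; ∑-distrib-+; sum-syntax)
open import Data.Bool using (Bool; true; false; if_then_else_; _∧_)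
open import Data.Bool.Properties using () renaming (_≟_ to _≟ᵇ_)
open import Data.Empty using (⊥-elim)
open import Data.Fin using (Fin; zero; suc; punchIn)
open import Data.Fin.Patterns using (0F; 1F; 2F; 3F; 4F; 5F)
open import Data.Fin.Properties using (injective⇒≤; punchInᵢ≢i) renaming (all? to allFin?)
open import Data.Fin.Subset using (Subset; inside; outside; _⊂_; ⊤; ∣_∣; ⁅_⁆; _∪_)
open import Data.Fin.Subset.Properties using (_∈?_; _⊂?_; nonempty?; ∣p∣≤n; p⊂q⇒∣p∣<∣q∣; x∈p⇒∣p-x∣<∣p∣)
open import Data.Integer as ℤ using (ℤ; +_; -[1+_]; -1ℤ; -<+)
open import Data.List using (List; []; _∷_; [_]; _++_; length; filter; concatMap; map; upTo; lookup)
open import Data.List.Properties using (map-++; map-∘; map-cong; map-id; ++-assoc; filter-++; filter-none)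
open import Data.List.Relation.Unary.All as All using (All; []; _∷_; all?)
import Data.List.Relation.Unary.All.Properties as All
open import Data.List.Relation.Unary.Any as Any using (Any; here; any?; index)
open import Data.List.Relation.Unary.Any.Properties using (lookup-index)
open import Data.List.Membership.Propositional.Properties.Core using (∉[])
open import Data.List.Relation.Unary.Linked using (Linked; _∷_)
open import Data.List.Relation.Unary.Unique.DecPropositional using (unique?)
open import Data.List.Membership.Propositional using (find) renaming (_∈_ to _∈ₗ_)
open import Data.List.Membership.Propositional.Properties
  using (∈-++⁺ˡ; ∈-++⁺ʳ; ∈-filter⁺; ∈-filter⁻; ∈-map⁺; ∈-concatMap⁺; ∈-upTo⁺)
import Data.List.Membership.DecPropositional as DecMembership
open import Data.List.Relation.Binary.Subset.Propositional using () renaming (_⊆_ to _⊆ₗ_)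
open import Data.List.Relation.Binary.Subset.Propositional.Properties using (⊆[]⇒≡[])
open import Data.Nat.Combinatorics using (_C_)
open import Data.Nat as ℕ using (ℕ; zero; suc; _+_; _≤_; _<_; s≤s; z≤n)
open import Data.Product using (_×_; _,_; proj₁; proj₂; ∃-syntax)
open import Data.Sum using (_⊎_; inj₁; inj₂)
open import Data.Vec using ([]; _∷_)
open import Data.Vec.Properties using (≡-dec)
open import Function using (_∘_)
open import Relation.Binary.Definitions using (Decidable; DecidableEquality)
open import Relation.Binary.PropositionalEquality
  using (_≡_; _≗_; refl; sym; trans; cong; cong₂; subst; module ≡-Reasoning)
open import Relation.Nullary using (¬_; Dec; yes; no; does)
open import Relation.Nullary.Decidable
  using (from-yes; dec-true; map′; _×-dec_; _⊎-dec_; _→-dec_; ¬?)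

_≟ₛ_ : ∀ {n} → DecidableEquality (Subset n)
_≟ₛ_ = ≡-dec _≟ᵇ_

_⊆ₗ?_ : ∀ {n} → Decidable (_⊆ₗ_ {A = Subset n})
xs ⊆ₗ? ys = map′ All.lookup All.tabulate (all? (λ x → DecMembership._∈?_ _≟ₛ_ x ys) xs)

inInterval? : ∀ {n} (G F K : Chain n) → Dec (InInterval G F K)
inInterval? G F K = (G ⊆ₗ? K) ×-dec (K ⊆ₗ? F)

countIn : ∀ {n} → Chain n → Chain n → List (Chain n) → ℕ
countIn G F xs = length (filter (inInterval? G F) xs)

nonemptyProper? : ∀ {n} (x : Subset n) → Dec (NonemptyProper x)
nonemptyProper? x = nonempty? x ×-dec ¬? (x ≟ₛ ⊤)

affirmed : ∀ {P : Set} (P? : Dec P) → does P? ≡ true → P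
affirmed (yes p) _ = p

refuted : ∀ {P : Set} (P? : Dec P) → does P? ≡ false → ¬ P
refuted (no ¬p) _ = ¬p

allSubsets-complete : ∀ {m} (x : Subset m) → x ∈ₗ allSubsets m
allSubsets-complete []            = here refl
allSubsets-complete (inside ∷ x)  = ∈-++⁺ˡ (∈-map⁺ (inside ∷_) (allSubsets-complete x))
allSubsets-complete {suc m} (outside ∷ x) =
  ∈-++⁺ʳ (map (inside ∷_) (allSubsets m)) (∈-map⁺ (outside ∷_) (allSubsets-complete x))

allLists-complete : ∀ {m} (K : Chain m) → K ∈ₗ allLists m (length K)
allLists-complete []      = here refl
allLists-complete {m} (x ∷ K) =
  ∈-concatMap⁺ (λ y → map (y ∷_) (allLists m (length K)))
    (Any.map (λ { refl → ∈-map⁺ (x ∷_) (allLists-complete K) }) (allSubsets-complete x))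

chain-length : ∀ {n} (x : Subset n) xs → Linked _⊂_ (x ∷ xs) → length xs + ∣ x ∣ ≤ n
chain-length     x []       _              = ∣p∣≤n x
chain-length {n} x (y ∷ ys) (x⊂y ∷ chain) = begin
  suc (length ys) + ∣ x ∣  ≡⟨ ℕP.+-suc (length ys) ∣ x ∣ ⟨
  length ys + suc ∣ x ∣    ≤⟨ ℕP.+-monoʳ-≤ (length ys) (p⊂q⇒∣p∣<∣q∣ x⊂y) ⟩
  length ys + ∣ y ∣        ≤⟨ chain-length y ys chain ⟩
  n                        ∎
  where open ℕP.≤-Reasoning

face-length≤n : ∀ {H K} → IsFace H K → length K ≤ n H
face-length≤n {K = []}    _ = z≤n
face-length≤n {H} {K = x ∷ xs} ((((_ , i∈x) , _) ∷ _) , chain , _) = begin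
  suc (length xs)          ≡⟨ ℕP.+-comm 1 (length xs) ⟩
  length xs + 1            ≤⟨ ℕP.+-monoʳ-≤ (length xs) (ℕP.≤-trans (s≤s z≤n) (x∈p⇒∣p-x∣<∣p∣ i∈x)) ⟩
  length xs + ∣ x ∣        ≤⟨ chain-length x xs chain ⟩
  n H                      ∎
  where open ℕP.≤-Reasoning

-- A pruned enumeration of the faces of Δ_H, for an arbitrary hypergraph H.
-- 'faceCount' filters all 2^{nl} lists of l subsets of [n]; 'facesAfter pre l'
-- only extends prefixes that can still begin a face, and yields exactly the
-- same list of faces.

module Enumeration (H : Hypergraph) where

  follows : Chain (n H) → Subset (n H) → Bool
  follows []          x = true
  follows (y ∷ [])    x = does (y ⊂? x)
  follows (_ ∷ z ∷ r) x = follows (z ∷ r) x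

  admissible : Chain (n H) → Subset (n H) → Bool
  admissible pre x = does (nonemptyProper? x) ∧ follows pre x

  facesAfter : Chain (n H) → ℕ → List (Chain (n H))
  facesAfter pre zero    = filter (isFace? H) [ pre ++ [] ]
  facesAfter pre (suc l) =
    concatMap (λ x → if admissible pre x then facesAfter (pre ++ [ x ]) l else [])
              (allSubsets (n H))

  faces : ℕ → List (Chain (n H))
  faces = facesAfter []

  follows-false : ∀ pre x r → follows pre x ≡ false → ¬ Linked _⊂_ (pre ++ x ∷ r)
  follows-false (y ∷ [])    x r eq (y⊂x ∷ _)   = refuted (y ⊂? x) eq y⊂x
  follows-false (_ ∷ z ∷ p) x r eq (_ ∷ chain) = follows-false (z ∷ p) x r eq chain

  pruning : ∀ pre x r → admissible pre x ≡ false → ¬ IsFace H (pre ++ x ∷ r)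
  pruning pre x r eq (proper , chain , _) with does (nonemptyProper? x) in x-proper
  ... | false = refuted (nonemptyProper? x) x-proper (All.lookup proper (∈-++⁺ʳ pre (here refl)))
  ... | true  = follows-false pre x r eq chain

  facesAfter-correct : ∀ l pre →
    filter (isFace? H) (map (pre ++_) (allLists (n H) l)) ≡ facesAfter pre l
  facesAfter-correct zero    pre = refl
  facesAfter-correct (suc l) pre = by-first-element (allSubsets (n H))
    where
    tails : List (Chain (n H))
    tails = allLists (n H) l

    extend : Subset (n H) → List (Chain (n H))
    extend x = map (x ∷_) tails

    branch : Subset (n H) → List (Chain (n H))
    branch x = if admissible pre x then facesAfter (pre ++ [ x ]) l else []

    with-first : ∀ x → filter (isFace? H) (map (pre ++_) (extend x)) ≡ branch x
    with-first x with admissible pre x in eq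
    ... | true  = trans (cong (filter (isFace? H))
                          (trans (sym (map-∘ tails)) (map-cong (λ r → sym (++-assoc pre [ x ] r)) tails)))
                        (facesAfter-correct l (pre ++ [ x ]))
    ... | false = trans (cong (filter (isFace? H)) (sym (map-∘ tails)))
                        (filter-none (isFace? H) (All.map⁺ (All.universal (λ r → pruning pre x r eq) tails)))

    by-first-element : ∀ xs →
      filter (isFace? H) (map (pre ++_) (concatMap extend xs)) ≡ concatMap branch xs
    by-first-element []       = refl
    by-first-element (x ∷ xs) = begin
      filter (isFace? H) (map (pre ++_) (extend x ++ concatMap extend xs))
        ≡⟨ cong (filter (isFace? H)) (map-++ (pre ++_) (extend x) (concatMap extend xs)) ⟩
      filter (isFace? H) (map (pre ++_) (extend x) ++ map (pre ++_) (concatMap extend xs))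
        ≡⟨ filter-++ (isFace? H) (map (pre ++_) (extend x)) (map (pre ++_) (concatMap extend xs)) ⟩
      filter (isFace? H) (map (pre ++_) (extend x)) ++ filter (isFace? H) (map (pre ++_) (concatMap extend xs))
        ≡⟨ cong₂ _++_ (with-first x) (by-first-element xs) ⟩
      branch x ++ concatMap branch xs
        ∎
      where open ≡-Reasoning

  faces-correct : ∀ l → filter (isFace? H) (allLists (n H) l) ≡ faces l
  faces-correct l = trans (cong (filter (isFace? H)) (sym (map-id (allLists (n H) l)))) (facesAfter-correct l [])

  faceCount≡length-faces : ∀ l → faceCount H l ≡ length (faces l)
  faceCount≡length-faces l = cong length (faces-correct l)

  faces-sound : ∀ l {K} → K ∈ₗ faces l → IsFace H K
  faces-sound l {K} K∈ =
    proj₂ (∈-filter⁻ (isFace? H) {xs = allLists (n H) l} (subst (K ∈ₗ_) (sym (faces-correct l)) K∈))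

  faces-complete : ∀ {K} → IsFace H K → K ∈ₗ faces (length K)
  faces-complete {K} face =
    subst (K ∈ₗ_) (faces-correct (length K)) (∈-filter⁺ (isFace? H) (allLists-complete K) face)

  facesUpTo : ℕ → List (Chain (n H))
  facesUpTo d = concatMap faces (upTo (suc d))

  facesUpTo-complete : ∀ {d} → (∀ {K} → IsFace H K → length K ≤ d) →
                       ∀ {K} → IsFace H K → K ∈ₗ facesUpTo d
  facesUpTo-complete short {K} face =
    ∈-concatMap⁺ faces (Any.map (λ { refl → faces-complete face }) (∈-upTo⁺ (s≤s (short face))))

  intervalCount : Chain (n H) → Chain (n H) → ℕ → ℕ
  intervalCount G F l = countIn G F (faces l)

open Enumeration

topSize-skip : ∀ H l → faceCount H (suc l) ≡ 0 → topSize H (suc l) ≡ topSize H l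
topSize-skip H l none rewrite none = refl

topSize-hit : ∀ H l → 0 < faceCount H (suc l) → topSize H (suc l) ≡ suc l
topSize-hit H l some rewrite dec-true (1 ℕ.≤? faceCount H (suc l)) some = refl

topSize-top : ∀ H d l → d ≤ l → (∀ i → d < i → i ≤ l → faceCount H i ≡ 0) →
              0 < faceCount H d → topSize H l ≡ d
topSize-top H zero    zero    _ _ _ = refl
topSize-top H d       (suc l) d≤1+l empty some with d ℕ.≟ suc l
... | yes refl = topSize-hit H l some
... | no  d≢   = trans (topSize-skip H l (empty (suc l) d<1+l ℕP.≤-refl))
                       (topSize-top H d l (ℕ.s≤s⁻¹ d<1+l)
                          (λ i d<i i≤l → empty i d<i (ℕP.m≤n⇒m≤1+n i≤l)) some)
  where
  d<1+l : d < suc l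
  d<1+l = ℕP.≤∧≢⇒< d≤1+l d≢

dimΔ+1-≡ : ∀ H d → d ≤ n H → (∀ l → d < l → l ≤ n H → faceCount H l ≡ 0) →
           0 < faceCount H d → dimΔ+1 H ≡ d
dimΔ+1-≡ H d = topSize-top H d (n H)

hFrom : ℕ → (ℕ → ℕ) → ℕ → ℤ
hFrom d f k = sumℤ (map term (upTo (suc k)))
  where
    term : ℕ → ℤ
    term i = (-1ℤ ℤ.^ (k ℕ.∸ i)) ℤ.* (+ ((d ℕ.∸ i) C (k ℕ.∸ i))) ℤ.* (+ f i)

hFrom-cong : ∀ {d f g} k → f ≗ g → hFrom d f k ≡ hFrom d g k
hFrom-cong {d} k f≗g = cong sumℤ (map-cong (λ i → cong (weighted i) (f≗g i)) (upTo (suc k)))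
  where
    weighted : ℕ → ℕ → ℤ
    weighted i c = (-1ℤ ℤ.^ (k ℕ.∸ i)) ℤ.* (+ ((d ℕ.∸ i) C (k ℕ.∸ i))) ℤ.* (+ c)

hEntry-from : ∀ H {d f} → dimΔ+1 H ≡ d → (∀ l → faceCount H l ≡ f l) → ∀ k → hEntry H k ≡ hFrom d f k
hEntry-from H refl counts k = hFrom-cong k counts

indicator : Bool → ℕ
indicator b = if b then 1 else 0

sum-mono-≤ : ∀ {m} {f g : Fin m → ℕ} → (∀ j → f j ≤ g j) → sum f ≤ sum g
sum-mono-≤ {zero}  _   = z≤n
sum-mono-≤ {suc m} f≤g = ℕP.+-mono-≤ (f≤g zero) (sum-mono-≤ (f≤g ∘ suc))

sum-mono-< : ∀ {m} {f g : Fin m → ℕ} → (∀ j → f j ≤ g j) → ∀ j₀ → f j₀ < g j₀ → sum f < sum g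
sum-mono-< {suc m} {f} {g} f≤g j₀ f<g = begin-strict
  sum f                          ≡⟨ sum-remove {i = j₀} f ⟩
  f j₀ + sum (f ∘ punchIn j₀)    <⟨ ℕP.+-mono-<-≤ f<g (sum-mono-≤ (f≤g ∘ punchIn j₀)) ⟩
  g j₀ + sum (g ∘ punchIn j₀)    ≡⟨ sum-remove {i = j₀} g ⟨
  sum g                          ∎
  where open ℕP.≤-Reasoning

sum-ones : ∀ m → ∑[ j < m ] 1 ≡ m
sum-ones zero    = refl
sum-ones (suc m) = cong suc (sum-ones m)

sum-slack : ∀ {m} {a b : Fin m → ℕ} → (∀ j → a j ≤ suc (b j)) → ∀ j₀ → a j₀ ≤ b j₀ →
            sum a < m + sum b
sum-slack {m} {a} {b} a≤b+1 j₀ a≤b = begin-strict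
  sum a                      <⟨ sum-mono-< a≤b+1 j₀ (s≤s a≤b) ⟩
  ∑[ j < m ] (1 + b j)       ≡⟨ ∑-distrib-+ (λ _ → 1) b ⟩
  ∑[ j < m ] 1 + sum b       ≡⟨ cong (_+ sum b) (sum-ones m) ⟩
  m + sum b                  ∎
  where open ℕP.≤-Reasoning

sum-indicator-unique : ∀ {m} (b : Fin m → Bool) j₀ → b j₀ ≡ true → (∀ j → b j ≡ true → j ≡ j₀) →
                       ∑[ j < m ] indicator (b j) ≡ 1
sum-indicator-unique {suc m} b j₀ b-j₀ unique = begin
  sum (indicator ∘ b)                                  ≡⟨ sum-remove {i = j₀} (indicator ∘ b) ⟩
  indicator (b j₀) + sum (indicator ∘ b ∘ punchIn j₀)  ≡⟨ cong₂ _+_ (cong indicator b-j₀) others-vanish ⟩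
  1                                                    ∎
  where
  open ≡-Reasoning
  other-false : ∀ i → indicator (b (punchIn j₀ i)) ≡ 0
  other-false i with b (punchIn j₀ i) in eq
  ... | false = refl
  ... | true  = ⊥-elim (punchInᵢ≢i j₀ i (unique (punchIn j₀ i) eq))
  others-vanish : sum (indicator ∘ b ∘ punchIn j₀) ≡ 0
  others-vanish = trans (sum-cong-≗ other-false) (sum-replicate-zero m)

length-filter-∷ : ∀ {A : Set} {P : A → Set} (P? : ∀ x → Dec (P x)) x xs →
                  length (filter P? (x ∷ xs)) ≡ indicator (does (P? x)) + length (filter P? xs)
length-filter-∷ P? x xs with does (P? x)
... | true  = refl
... | false = refl

length-partition : ∀ {A : Set} {m} {P : Fin m → A → Set} (P? : ∀ j x → Dec (P j x)) xs →
                   All (λ x → ∃[ j ] (P j x × (∀ i → P i x → i ≡ j))) xs →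
                   length xs ≡ ∑[ j < m ] length (filter (P? j) xs)
length-partition {m = m} P? []       []      = sym (sum-replicate-zero m)
length-partition {m = m} P? (x ∷ xs) ((j₀ , x∈j₀ , unique) ∷ rest) = begin
  1 + length xs
    ≡⟨ cong₂ _+_ (sym (sum-indicator-unique classOf j₀ (dec-true (P? j₀ x) x∈j₀)
                        (λ j eq → unique j (affirmed (P? j x) eq))))
                 (length-partition P? xs rest) ⟩
  ∑[ j < m ] indicator (classOf j) + ∑[ j < m ] length (filter (P? j) xs)
    ≡⟨ ∑-distrib-+ (indicator ∘ classOf) (λ j → length (filter (P? j) xs)) ⟨
  ∑[ j < m ] (indicator (classOf j) + length (filter (P? j) xs))
    ≡⟨ sum-cong-≗ (λ j → length-filter-∷ (P? j) x xs) ⟨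
  ∑[ j < m ] length (filter (P? j) (x ∷ xs))
    ∎
  where
  open ≡-Reasoning
  classOf : Fin m → Bool
  classOf j = does (P? j x)

distinct-members : ∀ {A : Set} {m} {xs : List A} (F : Fin m → A) → (∀ j → F j ∈ₗ xs) →
                   (∀ i j → F i ≡ F j → i ≡ j) → m ≤ length xs
distinct-members {xs = xs} F member injective = injective⇒≤ position-injective
  where
  position-injective : ∀ {i j} → index (member i) ≡ index (member j) → i ≡ j
  position-injective {i} {j} same = injective i j (begin
    F i                             ≡⟨ lookup-index (member i) ⟩
    lookup xs (index (member i))    ≡⟨ cong (lookup xs) same ⟩
    lookup xs (index (member j))    ≡⟨ lookup-index (member j) ⟨
    F j                             ∎)
    where open ≡-Reasoning

faceCount-partition :
  ∀ {H m} (G F : Fin m → Chain (n H)) →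
  (∀ K → IsFace H K → ∃[ j ] InInterval (G j) (F j) K) →
  (∀ K → IsFace H K → ∀ i j → InInterval (G i) (F i) K → InInterval (G j) (F j) K → i ≡ j) →
  ∀ l → faceCount H l ≡ ∑[ j < m ] intervalCount H (G j) (F j) l
faceCount-partition {H} G F cover disjoint l =
  trans (faceCount≡length-faces H l)
        (length-partition (λ j → inInterval? (G j) (F j)) (faces H l) (All.tabulate in-one-interval))
  where
  in-one-interval : ∀ {K} → K ∈ₗ faces H l →
                    ∃[ j ] (InInterval (G j) (F j) K × (∀ i → InInterval (G i) (F i) K → i ≡ j))
  in-one-interval {K} K∈ with cover K (faces-sound H l K∈)
  ... | j , K∈j = j , K∈j , λ i K∈i → disjoint K (faces-sound H l K∈) i j K∈i K∈j

-- They are decidable, so they can be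
-- checked on a concrete complex by evaluation; the lists are arguments so that
-- each list of faces is computed only once per check.

Extendable : ∀ {n} → ℕ → List (Chain n) → List (Chain n) → Set
Extendable d tops lows = All (λ K → length K ≡ d ⊎ Any (λ K′ → K ⊆ₗ K′ × ¬ K′ ⊆ₗ K) tops) lows

extendable? : ∀ {n} d (tops lows : List (Chain n)) → Dec (Extendable d tops lows)
extendable? d tops lows =
  all? (λ K → (length K ℕ.≟ d) ⊎-dec any? (λ K′ → (K ⊆ₗ? K′) ×-dec ¬? (K′ ⊆ₗ? K)) tops) lows

OneSlack : ∀ {n} (tops lows vs es : List (Chain n)) → Set
OneSlack tops lows vs es =
  All (λ F → All (λ G → G ⊆ₗ F → countIn G F es ≤ suc (countIn G F vs)) lows) tops

oneSlack? : ∀ {n} (tops lows vs es : List (Chain n)) → Dec (OneSlack tops lows vs es)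
oneSlack? tops lows vs es =
  all? (λ F → all? (λ G → (G ⊆ₗ? F) →-dec (countIn G F es ℕ.≤? suc (countIn G F vs))) lows) tops

NoSlack : ∀ {n} (tops vs es : List (Chain n)) → Set
NoSlack tops vs es = All (λ F → countIn [] F es ≤ countIn [] F vs) tops

noSlack? : ∀ {n} (tops vs es : List (Chain n)) → Dec (NoSlack tops vs es)
noSlack? tops vs es = all? (λ F → countIn [] F es ℕ.≤? countIn [] F vs) tops

facet-size : ∀ {H d} → (∀ {K} → IsFace H K → length K ≤ d) →
             Extendable d (faces H d) (facesUpTo H d) →
             ∀ {K} → IsFacet H K → K ∈ₗ faces H d
facet-size {H} {d} short extendable {K} (face , maximal)
  with All.lookup extendable (facesUpTo-complete H short face)
... | inj₁ size    = subst (λ l → K ∈ₗ faces H l) size (faces-complete H face)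
... | inj₂ larger with find larger
...   | K′ , K′∈ , K⊆K′ , K′⊈K = ⊥-elim (K′⊈K (maximal K′ (faces-sound H d K′∈) K⊆K′))

-- Summing over a partition into
-- m ≤ f_{d-1} intervals gives f_l < m + f_{l-1}, so Δ_H is not partitionable
-- as soon as f_{d-1} + f_{l-1} ≤ f_l.
partition-obstruction :
  ∀ {H} d l lows → IsFace H [] →
  (∀ {K} → IsFacet H K → K ∈ₗ faces H d) →
  (∀ {K} → IsFace H K → K ∈ₗ lows) →
  OneSlack (faces H d) lows (faces H l) (faces H (suc l)) →
  NoSlack (faces H d) (faces H l) (faces H (suc l)) →
  length (faces H d) + length (faces H l) ≤ length (faces H (suc l)) →
  ¬ Partitionable H
partition-obstruction {H} d l lows empty-face facets-top all-low one-slack no-slack counts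
                      (m , G , F , facet , F-injective , _ , G-face , cover , disjoint) =
  ℕP.<-irrefl refl (begin-strict
    faceCount H (suc l)                      ≡⟨ count (suc l) ⟩
    ∑[ j < m ] upper j                       <⟨ sum-slack upper≤lower+1 j₀ upper≤lower ⟩
    m + ∑[ j < m ] lower j                   ≡⟨ cong (_+_ m) (count l) ⟨
    m + faceCount H l                        ≤⟨ ℕP.+-mono-≤ facets≤ (ℕP.≤-reflexive (faceCount≡length-faces H l)) ⟩
    length (faces H d) + length (faces H l)  ≤⟨ counts ⟩
    length (faces H (suc l))                 ≡⟨ faceCount≡length-faces H (suc l) ⟨
    faceCount H (suc l)                      ∎)
  where
  open ℕP.≤-Reasoning
  count : ∀ k → faceCount H k ≡ ∑[ j < m ] intervalCount H (G j) (F j) k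
  count = faceCount-partition G F cover disjoint

  upper lower : Fin m → ℕ
  upper j = intervalCount H (G j) (F j) (suc l)
  lower j = intervalCount H (G j) (F j) l

  -- the facets are distinct d-faces
  facets≤ : m ≤ length (faces H d)
  facets≤ = distinct-members F (facets-top ∘ facet) F-injective

  upper≤lower+1 : ∀ j → upper j ≤ suc (lower j)
  upper≤lower+1 j = All.lookup (All.lookup one-slack (facets-top (facet j)))
                      (all-low (proj₁ (G-face j))) (proj₂ (G-face j))

  -- the interval containing the empty face starts at the empty face
  j₀ : Fin m
  j₀ = proj₁ (cover [] empty-face)

  G-j₀ : G j₀ ≡ []
  G-j₀ = ⊆[]⇒≡[] (proj₁ (proj₂ (cover [] empty-face)))

  upper≤lower : upper j₀ ≤ lower j₀
  upper≤lower = subst (λ G₀ → intervalCount H G₀ (F j₀) (suc l) ≤ intervalCount H G₀ (F j₀) l)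
                      (sym G-j₀) (All.lookup no-slack (facets-top (facet j₀)))

triple : Fin 6 → Fin 6 → Fin 6 → Subset 6
triple a b c = ⁅ a ⁆ ∪ ⁅ b ⁆ ∪ ⁅ c ⁆

H₀-edges : List (Subset 6)
H₀-edges = triple 0F 1F 2F ∷ triple 0F 3F 4F ∷ triple 1F 3F 5F ∷ []

H₀ : Hypergraph
H₀ = record
  { n          = 6
  ; edges      = H₀-edges
  ; distinct   = from-yes (unique? _≟ₛ_ H₀-edges)
  ; bigEdges   = from-yes (all? (λ e → 2 ℕ.≤? ∣ e ∣) H₀-edges)
  ; noIsolated = from-yes (allFin? (λ v → any? (v ∈?_) H₀-edges))
  ; antichain  = λ e∈ e′∈ → All.lookup (All.lookup incomparable e∈) e′∈
  }
  where
  incomparable : All (λ e → All (λ e′ → ¬ e ⊂ e′) H₀-edges) H₀-edges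
  incomparable = from-yes (all? (λ e → all? (λ e′ → ¬? (e ⊂? e′)) H₀-edges) H₀-edges)

H₀-uniform : Uniform H₀
H₀-uniform = 3 , from-yes (all? (λ e → ∣ e ∣ ℕ.≟ 3) H₀-edges)

H₀-f₀ : faceCount H₀ 1 ≡ 36
H₀-f₀ = faceCount≡length-faces H₀ 1

H₀-f₁ : faceCount H₀ 2 ≡ 108
H₀-f₁ = faceCount≡length-faces H₀ 2

H₀-f₂ : faceCount H₀ 3 ≡ 72
H₀-f₂ = faceCount≡length-faces H₀ 3

H₀-no-large-faces : ∀ l → 3 < l → l ≤ 6 → faces H₀ l ≡ []
H₀-no-large-faces 1 (s≤s ()) _
H₀-no-large-faces 2 (s≤s (s≤s ())) _
H₀-no-large-faces 3 (s≤s (s≤s (s≤s ()))) _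
H₀-no-large-faces 4 _ _ = refl
H₀-no-large-faces 5 _ _ = refl
H₀-no-large-faces 6 _ _ = refl
H₀-no-large-faces (suc (suc (suc (suc (suc (suc (suc _))))))) _ (s≤s (s≤s (s≤s (s≤s (s≤s (s≤s ()))))))

H₀-face-length : ∀ {K} → IsFace H₀ K → length K ≤ 3
H₀-face-length {K} face with length K ℕ.≤? 3
... | yes short = short
... | no  long  = ⊥-elim (∉[] (subst (K ∈ₗ_) (H₀-no-large-faces (length K) (ℕP.≰⇒> long) (face-length≤n {H₀} face))
                                  (faces-complete H₀ face)))

H₀-dim : dimΔ+1 H₀ ≡ 3
H₀-dim = dimΔ+1-≡ H₀ 3 (s≤s (s≤s (s≤s z≤n)))
           (λ l 3<l l≤6 → trans (faceCount≡length-faces H₀ l) (cong length (H₀-no-large-faces l 3<l l≤6)))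
           (subst (0 <_) (sym H₀-f₂) (s≤s z≤n))

H₀-h₃ : hEntry H₀ 3 ≡ -[1+ 0 ]
H₀-h₃ = hEntry-from H₀ {f = λ l → length (faces H₀ l)} H₀-dim (faceCount≡length-faces H₀) 3

H₀-negative-h : HasNegativeHEntry H₀
H₀-negative-h = 3 , subst (3 ≤_) (sym H₀-dim) ℕP.≤-refl , subst (ℤ._< + 0) (sym H₀-h₃) -<+

H₀-extendable : Extendable 3 (faces H₀ 3) (facesUpTo H₀ 3)
H₀-extendable = from-yes (extendable? 3 (faces H₀ 3) (facesUpTo H₀ 3))

H₀-one-slack : OneSlack (faces H₀ 3) (facesUpTo H₀ 3) (faces H₀ 1) (faces H₀ 2)
H₀-one-slack = from-yes (oneSlack? (faces H₀ 3) (facesUpTo H₀ 3) (faces H₀ 1) (faces H₀ 2))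

H₀-no-slack : NoSlack (faces H₀ 3) (faces H₀ 1) (faces H₀ 2)
H₀-no-slack = from-yes (noSlack? (faces H₀ 3) (faces H₀ 1) (faces H₀ 2))

-- f₂ + f₀ = 72 + 36 = 108 = f₁
H₀-not-partitionable : ¬ Partitionable H₀
H₀-not-partitionable =
  partition-obstruction {H₀} 3 1 (facesUpTo H₀ 3) (from-yes (isFace? H₀ []))
    (facet-size {H₀} {3} H₀-face-length H₀-extendable) (facesUpTo-complete H₀ H₀-face-length)
    H₀-one-slack H₀-no-slack ℕP.≤-refl

proposition4p7 : ∃[ H ] (Uniform H × HasNegativeHEntry H × ¬ Partitionable H)
proposition4p7 = H₀ , H₀-uniform , H₀-negative-h , H₀-not-partitionable
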